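{- If $G$ is a connected graph which is neither a complete graph nor a star, then $\alpha(M(G)) \le n(G) + \alpha(G) - 2$, where $M(G)$ is the Mycielskian of $G$.
   Context: All graphs are finite and simple. $n(G)$ is the number of vertices of $G$ and $\alpha(G)$ its independence number. A star is a complete bipartite graph $K_{1,m}$. The Mycielskian $M(G)$ of a graph $G$ is the graph with vertex set $V(G)\cup V'\cup\{w\}$, where $V'=\{x' : x\in V(G)\}$ is a set of new vertices and $w$ is a further new vertex, and with edge set $E(G)\cup\{xy' : xy\in E(G)\}\cup\{wx' : x'\in V'\}$. -}

module Defs where

open import Data.Nat using (ℕ; zero; suc; _+_; _≤_)
open import Data.Fin using (Fin; splitAt)
open import Data.Fin.Subset using (Subset; _∈_; ∣_∣)
open import Data.Sum using (_⊎_; inj₁; inj₂)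
open import Data.Product using (Σ; _×_; ∃)
open import Data.Empty using (⊥)
open import Data.Unit using (⊤)
open import Relation.Nullary using (¬_)
open import Relation.Binary.PropositionalEquality using (_≡_; _≢_)

Graph : ℕ → Set₁
Graph n = Fin n → Fin n → Set

record IsSimple {n : ℕ} (G : Graph n) : Set where
  field
    symmetric   : ∀ u v → G u v → G v u
    irreflexive : ∀ u → ¬ G u u

data Reachable {n : ℕ} (G : Graph n) : Fin n → Fin n → Set where
  here : ∀ {u} → Reachable G u u
  step : ∀ {u v w} → G u v → Reachable G v w → Reachable G u w

Connected : {n : ℕ} → Graph n → Set
Connected {n} G = ∀ (u v : Fin n) → Reachable G u v

IsComplete : {n : ℕ} → Graph n → Set
IsComplete {n} G = ∀ (u v : Fin n) → u ≢ v → G u v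

IsStar : {n : ℕ} → Graph n → Set
IsStar {n} G = Σ (Fin n) λ c →
  (∀ u → u ≢ c → G c u) × (∀ u v → u ≢ c → v ≢ c → ¬ G u v)

Independent : {n : ℕ} → Graph n → Subset n → Set
Independent G S = ∀ u v → u ∈ S → v ∈ S → ¬ G u v

IsIndependenceNumber : {n : ℕ} → Graph n → ℕ → Set
IsIndependenceNumber {n} G k =
  (Σ (Subset n) λ S → Independent G S × ∣ S ∣ ≡ k)
  × (∀ (S : Subset n) → Independent G S → ∣ S ∣ ≤ k)

-- Mycielskian. Vertex set Fin ((n + n) + 1): the first n vertices are V(G),
-- the next n are the copies x', the last one is w.
data MVertex (n : ℕ) : Set where
  orig : Fin n → MVertex n
  copy : Fin n → MVertex n
  hub  : MVertex n

classify : {n : ℕ} → Fin ((n + n) + 1) → MVertex n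
classify {n} i with splitAt (n + n) i
... | inj₂ _ = hub
... | inj₁ j with splitAt n j
...   | inj₁ x = orig x
...   | inj₂ x = copy x

MAdj : {n : ℕ} → Graph n → MVertex n → MVertex n → Set
MAdj G (orig x) (orig y) = G x y
MAdj G (orig x) (copy y) = G x y
MAdj G (orig x) hub      = ⊥
MAdj G (copy x) (orig y) = G x y
MAdj G (copy x) (copy y) = ⊥
MAdj G (copy x) hub      = ⊤
MAdj G hub      (orig y) = ⊥
MAdj G hub      (copy y) = ⊤
MAdj G hub      hub      = ⊥

Mycielskian : {n : ℕ} → Graph n → Graph ((n + n) + 1)
Mycielskian G u v = MAdj G (classify u) (classify v)

-- Let S be independent in M(G), and let A ⊆ V, B ⊆ V be the vertices x with
-- x ∈ S resp. x' ∈ S.  Then A is independent and no edge joins A to B.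
--   * If w ∈ S, then B = ∅, so |S| ≤ α + 1 ≤ n + α − 2, as n ≥ 3.
--   * Otherwise |S| = |A| + |B| = |A ∪ B| + |A ∩ B|, and (I, U) = (A ∩ B, A ∪ B)
--     is a sealed pair: I ⊆ U and no vertex of I has a neighbour in U.  The
--     sealed-pair bound |U| + |I| + 2 ≤ n + α holds in every connected non-star
--     graph with α ≥ 2: if I = ∅ use α ≥ 2; otherwise a neighbour v of a vertex
--     of I lies outside U, and either a second vertex lies outside U, or U ⊈ I
--     and I grows to a larger independent set, or I = V ∖ {v} and G is a star.
-- Non-completeness yields a non-edge, hence α ≥ 2 and n ≥ 3.  Adjacency is an
-- arbitrary relation, so this last step uses decidable adjacency; since the
-- conclusion is a decidable inequality, decidability may be assumed
-- (it holds up to double negation on a finite vertex set).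
module Submission where

open import Defs
open import Data.Nat using (ℕ; zero; suc; _+_; _≤_; _≤?_; s≤s)
open import Data.Nat.Properties using (+-suc; +-identityʳ; +-mono-≤; +-monoˡ-≤; ≤-trans; ≤-reflexive; module ≤-Reasoning)
open import Data.Bool using (true; false)
open import Data.Fin as Fin using (Fin; _↑ˡ_; _↑ʳ_)
open import Data.Fin.Properties using (_≟_; splitAt-↑ˡ; splitAt-↑ʳ; any?; all?; ¬∀⟶∃¬)
open import Data.Fin.Subset using (Subset; _∪_; _∩_; ⁅_⁆; _⊆_; _∉_; ∣_∣; _∈_; Empty; Nonempty)
open import Data.Fin.Subset.Properties
  using (_∈?_; nonempty?; Empty-unique; p⊂q⇒∣p∣<∣q∣; ∣⊤∣≡n; ∣⊥∣≡0; ∣⁅x⁆∣≡1; ∣p∣≤n;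
         x∈p∪q⁻; x∈p∩q⁻; p∩q⊆p; x∈⁅x⁆; x∈⁅y⁆⇒x≡y; ∈⊤; p⊆p∪q; q⊆p∪q)
open import Data.Vec using ([]; _∷_; here; tabulate; lookup)
open import Data.Vec.Properties using (tabulate∘lookup; lookup∘tabulate; []=⇒lookup; lookup⇒[]=)
open import Data.Sum using (_⊎_; inj₁; inj₂; [_,_]′)
open import Data.Product using (_×_; _,_; proj₁; ∃)
open import Data.Empty using (⊥-elim)
open import Data.Unit using (tt)
open import Relation.Nullary using (¬_; Dec; yes; no; contradiction; ¬?; _×-dec_; _→-dec_)
open import Relation.Nullary.Decidable using (decidable-stable; ¬¬-excluded-middle)
open import Relation.Binary.PropositionalEquality using (_≡_; _≢_; refl; sym; trans; cong; subst; subst₂; module ≡-Reasoning)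
open import Function using (_∘_)
open import Data.Nat.Solver using (module +-*-Solver)
open +-*-Solver using (solve; _:+_; _:=_; con)

∣p∪q∣+∣p∩q∣≡∣p∣+∣q∣ : ∀ {n} (p q : Subset n) → ∣ p ∪ q ∣ + ∣ p ∩ q ∣ ≡ ∣ p ∣ + ∣ q ∣
∣p∪q∣+∣p∩q∣≡∣p∣+∣q∣ []          []          = refl
∣p∪q∣+∣p∩q∣≡∣p∣+∣q∣ (true ∷ p)  (true ∷ q)  = cong suc (begin
  ∣ p ∪ q ∣ + suc ∣ p ∩ q ∣    ≡⟨ +-suc _ _ ⟩
  suc (∣ p ∪ q ∣ + ∣ p ∩ q ∣)  ≡⟨ cong suc (∣p∪q∣+∣p∩q∣≡∣p∣+∣q∣ p q) ⟩
  suc (∣ p ∣ + ∣ q ∣)          ≡⟨ +-suc _ _ ⟨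
  ∣ p ∣ + suc ∣ q ∣            ∎)
  where open ≡-Reasoning
∣p∪q∣+∣p∩q∣≡∣p∣+∣q∣ (true ∷ p)  (false ∷ q) = cong suc (∣p∪q∣+∣p∩q∣≡∣p∣+∣q∣ p q)
∣p∪q∣+∣p∩q∣≡∣p∣+∣q∣ (false ∷ p) (true ∷ q)  =
  trans (cong suc (∣p∪q∣+∣p∩q∣≡∣p∣+∣q∣ p q)) (sym (+-suc _ _))
∣p∪q∣+∣p∩q∣≡∣p∣+∣q∣ (false ∷ p) (false ∷ q) = ∣p∪q∣+∣p∩q∣≡∣p∣+∣q∣ p q

∣p∣<∣p∪⁅x⁆∣ : ∀ {n} {p : Subset n} {x} → x ∉ p → suc ∣ p ∣ ≤ ∣ p ∪ ⁅ x ⁆ ∣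
∣p∣<∣p∪⁅x⁆∣ {p = p} {x} x∉p =
  p⊂q⇒∣p∣<∣q∣ (p⊆p∪q ⁅ x ⁆ , x , q⊆p∪q p ⁅ x ⁆ (x∈⁅x⁆ x) , x∉p)

∣p∣<n : ∀ {n} {p : Subset n} {x} → x ∉ p → suc ∣ p ∣ ≤ n
∣p∣<n {n} {x = x} x∉p =
  ≤-trans (p⊂q⇒∣p∣<∣q∣ ((λ _ → ∈⊤) , x , ∈⊤ , x∉p)) (≤-reflexive (∣⊤∣≡n n))

∈p∪⁅x⁆⁻ : ∀ {n} {p : Subset n} {x y} → y ∈ p ∪ ⁅ x ⁆ → y ∈ p ⊎ y ≡ x
∈p∪⁅x⁆⁻ {p = p} {x} y∈ with x∈p∪q⁻ p ⁅ x ⁆ y∈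
... | inj₁ y∈p = inj₁ y∈p
... | inj₂ y∈x = inj₂ (x∈⁅y⁆⇒x≡y x y∈x)

2≤∣pair∣ : ∀ {n} {u v : Fin n} → u ≢ v → 2 ≤ ∣ ⁅ u ⁆ ∪ ⁅ v ⁆ ∣
2≤∣pair∣ {u = u} {v} u≢v =
  subst (λ k → suc k ≤ ∣ ⁅ u ⁆ ∪ ⁅ v ⁆ ∣) (∣⁅x⁆∣≡1 u) (∣p∣<∣p∪⁅x⁆∣ (λ v∈ → u≢v (sym (x∈⁅y⁆⇒x≡y u v∈))))

∣Empty∣≡0 : ∀ {n} {p : Subset n} → Empty p → ∣ p ∣ ≡ 0
∣Empty∣≡0 {n} p-empty = trans (cong ∣_∣ (Empty-unique p-empty)) (∣⊥∣≡0 n)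

subset-of-one : (p : Subset 1) → ∣ p ∣ ≡ 0 ⊎ Fin.zero ∈ p
subset-of-one (false ∷ []) = inj₁ refl
subset-of-one (true ∷ [])  = inj₂ here

restrict : ∀ {m k} → Subset k → (Fin m → Fin k) → Subset m
restrict S f = tabulate (λ i → lookup S (f i))

∈-restrict : ∀ {m k} (S : Subset k) (f : Fin m → Fin k) {x} → x ∈ restrict S f → f x ∈ S
∈-restrict S f {x} x∈ =
  lookup⇒[]= (f x) S (trans (sym (lookup∘tabulate _ x)) ([]=⇒lookup x∈))

∣restrict-split∣ : ∀ m {k} (S : Subset (m + k)) →
  ∣ S ∣ ≡ ∣ restrict S (_↑ˡ k) ∣ + ∣ restrict S (m ↑ʳ_) ∣
∣restrict-split∣ zero    S           = cong ∣_∣ (sym (tabulate∘lookup S))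
∣restrict-split∣ (suc m) (true ∷ S)  = cong suc (∣restrict-split∣ m S)
∣restrict-split∣ (suc m) (false ∷ S) = ∣restrict-split∣ m S

add-budgets : ∀ {x y m n} k l → k + x ≤ m → l + y ≤ n → x + y + (k + l) ≤ m + n
add-budgets {x} {y} {m} {n} k l kx≤m ly≤n = begin
  x + y + (k + l)  ≡⟨ shuffle ⟩
  (k + x) + (l + y) ≤⟨ +-mono-≤ kx≤m ly≤n ⟩
  m + n            ∎
  where
  open ≤-Reasoning
  shuffle : x + y + (k + l) ≡ (k + x) + (l + y)
  shuffle = solve 4 (λ x y k l → x :+ y :+ (k :+ l) := (k :+ x) :+ (l :+ y)) refl x y k l

first-step : ∀ {n} {G : Graph n} {x y} → x ≢ y → Reachable G x y → ∃ (G x)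
first-step x≢x here           = ⊥-elim (x≢x refl)
first-step _   (step {v = w} xw _) = w , xw

record Sealed {n : ℕ} (G : Graph n) (I U : Subset n) : Set where
  field
    inner  : I ⊆ U
    closed : ∀ x y → x ∈ I → y ∈ U → ¬ G x y

  independent : Independent G I
  independent x y x∈I y∈I = closed x y x∈I (inner y∈I)

module _ {n : ℕ} {G : Graph n} (simple : IsSimple G) where
  open IsSimple simple

  independent-⁅⁆ : ∀ x → Independent G ⁅ x ⁆
  independent-⁅⁆ x u v u∈ v∈ uv
    rewrite x∈⁅y⁆⇒x≡y x u∈ | x∈⁅y⁆⇒x≡y x v∈ = irreflexive x uv

  independent-adjoin : ∀ {p x} → Independent G p → (∀ y → y ∈ p → ¬ G y x) →
                       Independent G (p ∪ ⁅ x ⁆)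
  independent-adjoin ind-p x-free u v u∈ v∈ uv with ∈p∪⁅x⁆⁻ u∈ | ∈p∪⁅x⁆⁻ v∈
  ... | inj₁ u∈p  | inj₁ v∈p  = ind-p u v u∈p v∈p uv
  ... | inj₁ u∈p  | inj₂ refl = x-free u u∈p uv
  ... | inj₂ refl | inj₁ v∈p  = x-free v v∈p (symmetric u v uv)
  ... | inj₂ refl | inj₂ refl = irreflexive u uv

  non-edge⇒2≤α : ∀ {a u v} → (∀ S → Independent G S → ∣ S ∣ ≤ a) →
                 u ≢ v → ¬ G u v → 2 ≤ a
  non-edge⇒2≤α {u = u} {v} α-max u≢v ¬uv = ≤-trans (2≤∣pair∣ u≢v) (α-max _ pair-independent)
    where
    pair-independent : Independent G (⁅ u ⁆ ∪ ⁅ v ⁆)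
    pair-independent = independent-adjoin (independent-⁅⁆ u)
      (λ y y∈ yv → ¬uv (subst (λ z → G z v) (x∈⁅y⁆⇒x≡y u y∈) yv))

  -- A connected graph with a non-edge has at least three vertices: a walk
  -- between the two ends of the non-edge passes through a third vertex.
  non-edge⇒3≤n : Connected G → ∀ {u v} → u ≢ v → ¬ G u v → 3 ≤ n
  non-edge⇒3≤n conn {u} {v} u≢v ¬uv with first-step u≢v (conn u v)
  ... | w , uw = ≤-trans (s≤s (2≤∣pair∣ u≢v)) (∣p∣<n w∉pair)
    where
    w∉pair : w ∉ ⁅ u ⁆ ∪ ⁅ v ⁆
    w∉pair w∈ with ∈p∪⁅x⁆⁻ w∈
    ... | inj₁ w∈⁅u⁆ = irreflexive u (subst (G u) (x∈⁅y⁆⇒x≡y u w∈⁅u⁆) uw)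
    ... | inj₂ refl  = ¬uv uw

  -- If every vertex other than c lies in one independent set, then G is a
  -- star centred at c (connectivity joins every other vertex to c).
  star-centred-at : Connected G → ∀ c (I : Subset n) → Independent G I →
                    (∀ u → u ≢ c → u ∈ I) → IsStar G
  star-centred-at conn c I ind-I covers =
    c , adjacent-to-c , λ u v u≢c v≢c → ind-I u v (covers u u≢c) (covers v v≢c)
    where
    adjacent-to-c : ∀ u → u ≢ c → G c u
    adjacent-to-c u u≢c with first-step u≢c (conn u c)
    ... | w , uw with w ≟ c
    ...   | yes refl = symmetric u w uw
    ...   | no  w≢c  = ⊥-elim (ind-I u w (covers u u≢c) (covers w w≢c) uw)

  module _ (conn : Connected G) (not-star : ¬ IsStar G) where

    -- A neighbour of a vertex of I lies outside U.  Such a neighbour exists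
    -- unless G has a single vertex, in which case G is (trivially) a star.
    sealed-escape : ∀ {I U} → Sealed G I U → Nonempty I → ∃ λ v → v ∉ U
    sealed-escape {I} s (x , x∈I) with any? (λ y → ¬? (y ≟ x))
    ... | yes (y , y≢x) with first-step (y≢x ∘ sym) (conn x y)
    ...   | v , xv = v , λ v∈U → Sealed.closed s x v x∈I v∈U xv
    sealed-escape {I} s (x , x∈I) | no no-other =
      ⊥-elim (not-star (star-centred-at conn x I (Sealed.independent s)
                          (λ u u≢x → ⊥-elim (no-other (u , u≢x)))))

    module _ {a : ℕ} (α-max : ∀ S → Independent G S → ∣ S ∣ ≤ a) where

      -- With a vertex v outside U, one more unit is saved: on the U side if a
      -- second vertex is outside U, on the I side if some vertex of U can be
      -- added to I; otherwise I = V ∖ {v} and G would be a star.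
      sealed-bound-outside : ∀ {I U} → Sealed G I U → ∀ {v} → v ∉ U →
                             ∣ U ∣ + ∣ I ∣ + 2 ≤ n + a
      sealed-bound-outside {I} {U} s {v} v∉U
        with any? (λ u → ¬? (u ≟ v) ×-dec ¬? (u ∈? U))
      ... | yes (u , u≢v , u∉U) =
        add-budgets 2 0 (≤-trans (s≤s (∣p∣<∣p∪⁅x⁆∣ u∉U)) (∣p∣<n v∉U∪⁅u⁆))
                        (α-max I (Sealed.independent s))
        where
        v∉U∪⁅u⁆ : v ∉ U ∪ ⁅ u ⁆
        v∉U∪⁅u⁆ v∈ = [ v∉U , u≢v ∘ sym ]′ (∈p∪⁅x⁆⁻ v∈)
      ... | no none-else with any? (λ u → (u ∈? U) ×-dec ¬? (u ∈? I))
      ...   | yes (u , u∈U , u∉I) =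
        add-budgets 1 1 (∣p∣<n v∉U) (≤-trans (∣p∣<∣p∪⁅x⁆∣ u∉I) (α-max _ ind-I∪⁅u⁆))
        where
        ind-I∪⁅u⁆ : Independent G (I ∪ ⁅ u ⁆)
        ind-I∪⁅u⁆ = independent-adjoin (Sealed.independent s) (λ y y∈I → Sealed.closed s y u y∈I u∈U)
      ...   | no U⊆I = ⊥-elim (not-star (star-centred-at conn v I (Sealed.independent s) covers))
        where
        covers : ∀ u → u ≢ v → u ∈ I
        covers u u≢v with u ∈? I | u ∈? U
        ... | yes u∈I | _        = u∈I
        ... | no  u∉I | yes u∈U  = ⊥-elim (U⊆I (u , u∈U , u∉I))
        ... | no  _   | no  u∉U  = ⊥-elim (none-else (u , u≢v , u∉U))

      sealed-bound : 2 ≤ a → ∀ {I U} → Sealed G I U → ∣ U ∣ + ∣ I ∣ + 2 ≤ n + a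
      sealed-bound 2≤a {I} {U} s with nonempty? I
      ... | no  I-empty = add-budgets 0 2 (∣p∣≤n U) (subst (λ k → 2 + k ≤ a) (sym (∣Empty∣≡0 I-empty)) 2≤a)
      ... | yes I-nonempty with sealed-escape s I-nonempty
      ...   | v , v∉U = sealed-bound-outside s v∉U

cross-free⇒sealed : ∀ {n} {G : Graph n} {A B : Subset n} → Independent G A →
                    (∀ x y → x ∈ A → y ∈ B → ¬ G x y) → Sealed G (A ∩ B) (A ∪ B)
cross-free⇒sealed {A = A} {B} ind-A cross = record
  { inner  = λ x∈A∩B → p⊆p∪q B (p∩q⊆p A B x∈A∩B)
  ; closed = λ x y x∈A∩B y∈A∪B →
      [ ind-A x y (x∈A x∈A∩B) , cross x y (x∈A x∈A∩B) ]′ (x∈p∪q⁻ A B y∈A∪B)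
  }
  where
  x∈A : ∀ {x} → x ∈ A ∩ B → x ∈ A
  x∈A x∈A∩B = proj₁ (x∈p∩q⁻ A B x∈A∩B)

origᵛ copyᵛ : ∀ {n} → Fin n → Fin ((n + n) + 1)
origᵛ {n} x = (x ↑ˡ n) ↑ˡ 1
copyᵛ {n} x = (n ↑ʳ x) ↑ˡ 1

hubᵛ : ∀ {n} → Fin ((n + n) + 1)
hubᵛ {n} = (n + n) ↑ʳ Fin.zero

classify-origᵛ : ∀ {n} (x : Fin n) → classify {n} (origᵛ x) ≡ orig x
classify-origᵛ {n} x rewrite splitAt-↑ˡ (n + n) (x ↑ˡ n) 1 | splitAt-↑ˡ n x n = refl

classify-copyᵛ : ∀ {n} (x : Fin n) → classify {n} (copyᵛ x) ≡ copy x
classify-copyᵛ {n} x rewrite splitAt-↑ˡ (n + n) (n ↑ʳ x) 1 | splitAt-↑ʳ n n x = refl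

classify-hubᵛ : ∀ {n} → classify {n} (hubᵛ {n}) ≡ hub
classify-hubᵛ {n} rewrite splitAt-↑ʳ (n + n) 1 Fin.zero = refl

mycielski-edge : ∀ {n} {G : Graph n} {u v s t} → classify u ≡ s → classify v ≡ t →
                 MAdj G s t → Mycielskian G u v
mycielski-edge {G = G} u≡s v≡t = subst₂ (MAdj G) (sym u≡s) (sym v≡t)

origPart copyPart : ∀ {n} → Subset ((n + n) + 1) → Subset n
origPart {n} S = restrict (restrict S (_↑ˡ 1)) (_↑ˡ n)
copyPart {n} S = restrict (restrict S (_↑ˡ 1)) (n ↑ʳ_)

hubPart : ∀ {n} → Subset ((n + n) + 1) → Subset 1
hubPart {n} S = restrict S ((n + n) ↑ʳ_)

∣S∣≡∣A∣+∣B∣+∣H∣ : ∀ {n} (S : Subset ((n + n) + 1)) →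
                  ∣ S ∣ ≡ ∣ origPart {n} S ∣ + ∣ copyPart {n} S ∣ + ∣ hubPart {n} S ∣
∣S∣≡∣A∣+∣B∣+∣H∣ {n} S = trans (∣restrict-split∣ (n + n) S)
  (cong (_+ ∣ hubPart {n} S ∣) (∣restrict-split∣ n (restrict S (_↑ˡ 1))))

∈-origPart : ∀ {n} (S : Subset ((n + n) + 1)) {x} → x ∈ origPart {n} S → origᵛ x ∈ S
∈-origPart {n} S = ∈-restrict S (_↑ˡ 1) ∘ ∈-restrict (restrict S (_↑ˡ 1)) (_↑ˡ n)

∈-copyPart : ∀ {n} (S : Subset ((n + n) + 1)) {x} → x ∈ copyPart {n} S → copyᵛ x ∈ S
∈-copyPart {n} S = ∈-restrict S (_↑ˡ 1) ∘ ∈-restrict (restrict S (_↑ˡ 1)) (n ↑ʳ_)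

∈-hubPart : ∀ {n} (S : Subset ((n + n) + 1)) → Fin.zero ∈ hubPart {n} S → hubᵛ {n} ∈ S
∈-hubPart {n} S = ∈-restrict S ((n + n) ↑ʳ_)

module _ {n : ℕ} {G : Graph n} {S : Subset ((n + n) + 1)}
         (ind-S : Independent (Mycielskian G) S) where

  origPart-independent : Independent G (origPart {n} S)
  origPart-independent x y x∈ y∈ xy = ind-S (origᵛ x) (origᵛ y)
    (∈-origPart {n} S x∈) (∈-origPart {n} S y∈)
    (mycielski-edge (classify-origᵛ x) (classify-origᵛ y) xy)

  -- No edge of G joins A to B, since xy ∈ E(G) makes x adjacent to y'.
  orig-copy-nonadjacent : ∀ x y → x ∈ origPart {n} S → y ∈ copyPart {n} S → ¬ G x y
  orig-copy-nonadjacent x y x∈ y∈ xy = ind-S (origᵛ x) (copyᵛ y)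
    (∈-origPart {n} S x∈) (∈-copyPart {n} S y∈)
    (mycielski-edge (classify-origᵛ x) (classify-copyᵛ y) xy)

  -- w is adjacent to every copy, so w ∈ S forces B = ∅.
  hub⇒copyPart-empty : Fin.zero ∈ hubPart {n} S → Empty (copyPart {n} S)
  hub⇒copyPart-empty w∈ (y , y∈) = ind-S (copyᵛ y) (hubᵛ {n})
    (∈-copyPart {n} S y∈) (∈-hubPart {n} S w∈)
    (mycielski-edge (classify-copyᵛ y) (classify-hubᵛ {n}) tt)

hub-bound : ∀ {n} {G : Graph n} {a} → (∀ S → Independent G S → ∣ S ∣ ≤ a) → 3 ≤ n →
            ∀ {S : Subset ((n + n) + 1)} → Independent (Mycielskian G) S →
            Fin.zero ∈ hubPart {n} S → ∣ S ∣ + 2 ≤ n + a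
hub-bound {n} {G} {a} α-max 3≤n {S} ind-S w∈ = begin
  ∣ S ∣ + 2                          ≡⟨ cong (_+ 2) (∣S∣≡∣A∣+∣B∣+∣H∣ {n} S) ⟩
  ∣ A ∣ + ∣ B ∣ + ∣ H ∣ + 2          ≡⟨ cong (λ k → ∣ A ∣ + k + ∣ H ∣ + 2) ∣B∣≡0 ⟩
  ∣ A ∣ + 0 + ∣ H ∣ + 2              ≤⟨ +-monoˡ-≤ 2 (+-mono-≤ (+-monoˡ-≤ 0 ∣A∣≤a) (∣p∣≤n H)) ⟩
  a + 0 + 1 + 2                      ≡⟨ solve 1 (λ a → a :+ con 0 :+ con 1 :+ con 2 := con 3 :+ a) refl a ⟩
  3 + a                              ≤⟨ +-monoˡ-≤ a 3≤n ⟩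
  n + a                              ∎
  where
  open ≤-Reasoning
  A B : Subset n
  A = origPart {n} S
  B = copyPart {n} S
  H : Subset 1
  H = hubPart {n} S
  ∣A∣≤a : ∣ A ∣ ≤ a
  ∣A∣≤a = α-max A (origPart-independent {n} ind-S)
  ∣B∣≡0 : ∣ B ∣ ≡ 0
  ∣B∣≡0 = ∣Empty∣≡0 (hub⇒copyPart-empty {n} ind-S w∈)

hub-free-bound : ∀ {n} {G : Graph n} → IsSimple G → Connected G → ¬ IsStar G →
                 ∀ {a} → (∀ S → Independent G S → ∣ S ∣ ≤ a) → 2 ≤ a →
                 ∀ {S : Subset ((n + n) + 1)} → Independent (Mycielskian G) S →
                 ∣ hubPart {n} S ∣ ≡ 0 → ∣ S ∣ + 2 ≤ n + a
hub-free-bound {n} {G} simple conn not-star {a} α-max 2≤a {S} ind-S ∣H∣≡0 = begin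
  ∣ S ∣ + 2                          ≡⟨ cong (_+ 2) (∣S∣≡∣A∣+∣B∣+∣H∣ {n} S) ⟩
  ∣ A ∣ + ∣ B ∣ + ∣ H ∣ + 2          ≡⟨ cong (λ k → ∣ A ∣ + ∣ B ∣ + k + 2) ∣H∣≡0 ⟩
  ∣ A ∣ + ∣ B ∣ + 0 + 2              ≡⟨ cong (_+ 2) (+-identityʳ _) ⟩
  ∣ A ∣ + ∣ B ∣ + 2                  ≡⟨ cong (_+ 2) (∣p∪q∣+∣p∩q∣≡∣p∣+∣q∣ A B) ⟨
  ∣ A ∪ B ∣ + ∣ A ∩ B ∣ + 2          ≤⟨ sealed-bound simple conn not-star α-max 2≤a sealed ⟩
  n + a                              ∎
  where
  open ≤-Reasoning
  A B : Subset n
  A = origPart {n} S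
  B = copyPart {n} S
  H : Subset 1
  H = hubPart {n} S
  sealed : Sealed G (A ∩ B) (A ∪ B)
  sealed = cross-free⇒sealed (origPart-independent {n} ind-S) (orig-copy-nonadjacent {n} ind-S)

mycielski-bound : ∀ {n} {G : Graph n} → IsSimple G → Connected G → ¬ IsStar G →
                  ∀ {a} → (∀ S → Independent G S → ∣ S ∣ ≤ a) → 2 ≤ a → 3 ≤ n →
                  (S : Subset ((n + n) + 1)) → Independent (Mycielskian G) S →
                  ∣ S ∣ + 2 ≤ n + a
mycielski-bound {n} simple conn not-star α-max 2≤a 3≤n S ind-S =
  [ hub-free-bound simple conn not-star α-max 2≤a ind-S , hub-bound α-max 3≤n ind-S ]′
    (subset-of-one (hubPart {n} S))

¬¬-∀-Fin : ∀ {n p} {P : Fin n → Set p} → (∀ i → ¬ ¬ P i) → ¬ ¬ (∀ i → P i)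
¬¬-∀-Fin {zero}  _      ¬all = ¬all (λ ())
¬¬-∀-Fin {suc n} ¬¬each ¬all = ¬¬each Fin.zero λ p₀ →
  ¬¬-∀-Fin (¬¬each ∘ Fin.suc) λ p₊ → ¬all λ { Fin.zero → p₀ ; (Fin.suc i) → p₊ i }

¬¬-decidable : ∀ {n} (G : Graph n) → ¬ ¬ (∀ u v → Dec (G u v))
¬¬-decidable G = ¬¬-∀-Fin λ u → ¬¬-∀-Fin λ v → ¬¬-excluded-middle

non-edge : ∀ {n} {G : Graph n} → (∀ u v → Dec (G u v)) → ¬ IsComplete G →
           ∃ λ u → ∃ λ v → u ≢ v × ¬ G u v
non-edge {n} {G} adj? not-complete =
  let (u , not-all-edges) = ¬∀⟶∃¬ n (λ u → ∀ v → u ≢ v → G u v) (λ u → all? (edge? u)) not-complete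
      (v , not-edge)      = ¬∀⟶∃¬ n (λ v → u ≢ v → G u v) (edge? u) not-all-edges
  in u , v , (λ u≡v → not-edge (λ u≢v → contradiction u≡v u≢v)) , (λ uv → not-edge (λ _ → uv))
  where
  edge? : ∀ u v → Dec (u ≢ v → G u v)
  edge? u v = ¬? (u ≟ v) →-dec adj? u v

proposition2p3 : ∀ (n : ℕ) (G : Graph n) → IsSimple G → Connected G
    → ¬ IsComplete G → ¬ IsStar G
    → ∀ (a b : ℕ) → IsIndependenceNumber G a
    → IsIndependenceNumber (Mycielskian G) b
    → b + 2 ≤ n + a
proposition2p3 n G simple conn not-complete not-star a b (_ , α-max) ((S , ind-S , ∣S∣≡b) , _) =
  decidable-stable (b + 2 ≤? n + a) λ bound-fails → ¬¬-decidable G λ adj? →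
    let (u , v , u≢v , ¬uv) = non-edge adj? not-complete
        2≤a = non-edge⇒2≤α simple α-max u≢v ¬uv
        3≤n = non-edge⇒3≤n simple conn u≢v ¬uv
    in bound-fails (subst (λ k → k + 2 ≤ n + a) ∣S∣≡b
         (mycielski-bound simple conn not-star α-max 2≤a 3≤n S ind-S))
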